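{- Let $n=2^s p_1^{\alpha_1}\cdots p_k^{\alpha_k}$ with $k\ge1$, $s\in\{0,1\}$, positive integers $\alpha_i$, and distinct primes $p_i\equiv1\pmod 4$. Then $G_n$ is a cycle if and only if $n=5$ or $n=10$.
   Context: The graph $G_n$ has vertex set $\mathbb{Z}_n$, and distinct $a,b$ are adjacent iff $a-b\equiv x^2\pmod n$ for some unit $x\in\mathbb{Z}_n^{\ast}$. -}

module Defs where

open import Data.Nat using (ℕ; zero; suc; _+_; _*_; _^_; _≤_; _%_)
open import Data.Nat.Primality using (Prime)
open import Data.Nat.Coprimality using (Coprime)
open import Data.Integer using (ℤ; +_; _-_)
open import Data.Integer.Divisibility using () renaming (_∣_ to _∣ℤ_)
open import Data.Fin using (Fin; toℕ)
open import Data.List using (List; map; length)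
open import Data.Nat.ListAction using (product)
open import Data.List.Relation.Unary.All using (All)
open import Data.List.Relation.Unary.Unique.Propositional using (Unique)
open import Data.Product using (Σ; _×_; _,_; proj₁; ∃-syntax)
open import Data.Sum using (_⊎_)
open import Function.Definitions using (Injective)
open import Function.Bundles using (_⇔_)
open import Relation.Binary.PropositionalEquality using (_≡_; _≢_)

Adj : (n : ℕ) → Fin n → Fin n → Set
Adj n a b = a ≢ b × ∃[ x ] (Coprime (toℕ {n} x) n
              × (+ n) ∣ℤ ((+ toℕ a - + toℕ b) - + (toℕ x * toℕ x)))

Next : (n : ℕ) → Fin n → Fin n → Set
Next n i j = suc (toℕ i) ≡ toℕ j ⊎ (suc (toℕ i) ≡ n × toℕ j ≡ 0)

-- G_n is a cycle: n ≥ 3 and G_n is isomorphic to the cycle graph C_n,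
-- i.e. there is a bijective relabelling σ of the vertices such that
-- σ i ~ σ j exactly when i, j are consecutive on the cycle.
-- (σ injective on Fin n, hence bijective.)
GIsCycle : ℕ → Set
GIsCycle n = 3 ≤ n × Σ (Fin n → Fin n) λ σ → Injective _≡_ _≡_ σ
  × (∀ i j → Adj n (σ i) (σ j) ⇔ (Next n i j ⊎ Next n j i))

primePower : ℕ × ℕ → ℕ
primePower (p , α) = p ^ α

GoodPrime : ℕ × ℕ → Set
GoodPrime (p , α) = Prime p × p % 4 ≡ 1 × 1 ≤ α

HasForm : ℕ → Set
HasForm n = ∃[ s ] ∃[ ps ] (s ≤ 1 × 1 ≤ length ps × Unique (map proj₁ ps)
              × All GoodPrime ps × n ≡ 2 ^ s * product (map primePower ps))

-- Every prime divisor of n is 2 or ≡ 1 (mod 4), and 2 divides n at most once, so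
-- 3, 4 and 7 do not divide n.  Hence 1, 3 and 7 are units of ℤₙ, and for every such
-- n ≥ 3 other than 5 and 10 their squares 1, 9 and 49 are distinct nonzero residues
-- (for n ≥ 50 trivially, below 50 by evaluation).  So vertex 0 has three neighbours
-- in Gₙ, which a cycle does not allow.  For n = 5 and n = 10 the unit squares are
-- exactly ±1, so Gₙ is the cycle 0, 1, …, n − 1 itself.

module Submission where

open import Defs
open import Data.Nat
  using (ℕ; zero; suc; _+_; _*_; _∸_; _^_; _≤_; _<_; _%_; _/_; s≤s; NonZero)
  renaming (_≟_ to _≟ℕ_)
open import Data.Nat.DivMod using (_mod_; m≡m%n+[m/n]*n; m%n<n; m%n≤m)
open import Data.Nat.Properties
  using (≤-trans; <-≤-trans; ≮⇒≥; _<?_; _≤?_; *-identityˡ; m+n∸m≡n; [m+n]∸[m+o]≡n∸o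
        ; *-distribʳ-∸; suc-injective; <-irrefl; 1+n≰n)
open import Data.Nat.Divisibility using (_∣_; _∣?_; ∣⇒≤; divides; ∣1⇒≡1; m%n≡0⇒n∣m; *-cancelˡ-∣; ∣-trans)
open import Data.Nat.Primality using (Prime; prime?; ¬prime[1]; prime[2]; euclidsLemma; prime⇒irreducible)
open import Data.Nat.Coprimality using (Coprime; coprime?; 1-coprimeTo)
open import Data.Nat.ListAction using (product)
open import Data.Fin using (Fin; zero; toℕ; fromℕ<; punchOut; _≟_)
open import Data.Fin.Properties
  using (all?; toℕ-injective; toℕ<n; toℕ-fromℕ<; any?; injective⇒≤; punchOut-injective)
open import Data.Integer using (+_; _-_; _⊖_)
import Data.Integer as ℤ
import Data.Integer.Properties as ℤ
open import Data.Integer.Divisibility using () renaming (_∣_ to _∣ℤ_)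
open import Data.List using (map)
open import Data.List.Relation.Unary.All as All using (All; []; _∷_)
open import Data.List.Relation.Unary.All.Properties using (map⁺)
open import Data.Product using (_×_; _,_; proj₁; proj₂)
open import Data.Sum using (_⊎_; inj₁; inj₂; [_,_]′)
open import Data.Empty using (⊥; ⊥-elim)
open import Function using (id; _∘_)
open import Function.Bundles using (Equivalence; _⇔_; mk⇔)
open import Function.Definitions using (Injective; StrictlySurjective)
open import Level using (0ℓ)
open import Relation.Nullary using (¬_; ¬?; yes; no; contradiction)
open import Relation.Nullary.Decidable using (True; toWitness; _×-dec_; _⊎-dec_; _→-dec_)
open import Relation.Binary using () renaming (Decidable to Decidable₂)
open import Relation.Unary using (Pred; Decidable; _∪_; _⊆_)
open import Relation.Binary.PropositionalEquality
  using (_≡_; _≢_; refl; sym; trans; cong; cong₂; subst; subst₂; module ≡-Reasoning)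

AllPrimeDivisors : Pred ℕ 0ℓ → Pred ℕ 0ℓ
AllPrimeDivisors P m = ∀ {q} → Prime q → q ∣ m → P q

module _ {P Q : Pred ℕ 0ℓ} where

  allPrimeDivisors-mono : P ⊆ Q → AllPrimeDivisors P ⊆ AllPrimeDivisors Q
  allPrimeDivisors-mono P⊆Q hm qp q∣m = P⊆Q (hm qp q∣m)

  allPrimeDivisors-* : ∀ {a b} → AllPrimeDivisors P a → AllPrimeDivisors Q b →
                       AllPrimeDivisors (P ∪ Q) (a * b)
  allPrimeDivisors-* {a} {b} ha hb qp q∣ab =
    [ (λ q∣a → inj₁ (ha qp q∣a)) , (λ q∣b → inj₂ (hb qp q∣b)) ]′ (euclidsLemma a b qp q∣ab)

module _ {P : Pred ℕ 0ℓ} where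

  allPrimeDivisors-1 : AllPrimeDivisors P 1
  allPrimeDivisors-1 qp q∣1 = ⊥-elim (¬prime[1] (subst Prime (∣1⇒≡1 q∣1) qp))

  prime⇒allPrimeDivisors : ∀ {p} → Prime p → P p → AllPrimeDivisors P p
  prime⇒allPrimeDivisors pp Pp qp q∣p with prime⇒irreducible pp q∣p
  ... | inj₁ refl = ⊥-elim (¬prime[1] qp)
  ... | inj₂ refl = Pp

  allPrimeDivisors-^ : ∀ {a} → AllPrimeDivisors P a → ∀ k → AllPrimeDivisors P (a ^ k)
  allPrimeDivisors-^ ha zero    = allPrimeDivisors-1
  allPrimeDivisors-^ ha (suc k) =
    allPrimeDivisors-mono [ id , id ]′ (allPrimeDivisors-* ha (allPrimeDivisors-^ ha k))

  allPrimeDivisors-product : ∀ {ms} → All (AllPrimeDivisors P) ms → AllPrimeDivisors P (product ms)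
  allPrimeDivisors-product []         = allPrimeDivisors-1
  allPrimeDivisors-product (hm ∷ hms) =
    allPrimeDivisors-mono [ id , id ]′ (allPrimeDivisors-* hm (allPrimeDivisors-product hms))

goodPrimePower-primeDivisors : ∀ {pα} → GoodPrime pα →
                               AllPrimeDivisors (λ q → q % 4 ≡ 1) (primePower pα)
goodPrimePower-primeDivisors {p , α} (pp , p≡1 , _) = allPrimeDivisors-^ (prime⇒allPrimeDivisors pp p≡1) α

oddPart-primeDivisors : ∀ {ps} → All GoodPrime ps →
                        AllPrimeDivisors (λ q → q % 4 ≡ 1) (product (map primePower ps))
oddPart-primeDivisors good = allPrimeDivisors-product (map⁺ (All.map goodPrimePower-primeDivisors good))

HasForm⇒primeDivisors : ∀ {n} → HasForm n → AllPrimeDivisors (λ q → q ≡ 2 ⊎ q % 4 ≡ 1) n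
HasForm⇒primeDivisors (s , ps , _ , _ , _ , good , refl) =
  allPrimeDivisors-* (allPrimeDivisors-^ (prime⇒allPrimeDivisors {_≡ 2} prime[2] refl) s)
                     (oddPart-primeDivisors good)

HasForm∧prime≡3mod4⇒∤ : ∀ {n q} → HasForm n → Prime q → q % 4 ≡ 3 → ¬ q ∣ n
HasForm∧prime≡3mod4⇒∤ hf qp q≡3 q∣n with HasForm⇒primeDivisors hf qp q∣n | q≡3
... | inj₁ refl | ()
... | inj₂ q≡1  | q≡3′ with trans (sym q≡1) q≡3′
...   | ()

HasForm⇒4∤ : ∀ {n} → HasForm n → ¬ 4 ∣ n
HasForm⇒4∤ (s , ps , s≤1 , _ , _ , good , refl) 4∣n = 2∤oddPart (2∣oddPart s s≤1 4∣n)
  where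
  oddPart : ℕ
  oddPart = product (map primePower ps)
  2∤oddPart : ¬ 2 ∣ oddPart
  2∤oddPart 2∣m with oddPart-primeDivisors good prime[2] 2∣m
  ... | ()
  2∣oddPart : ∀ s → s ≤ 1 → 4 ∣ 2 ^ s * oddPart → 2 ∣ oddPart
  2∣oddPart zero    _ 4∣m = ∣-trans (divides 2 refl) (subst (4 ∣_) (*-identityˡ oddPart) 4∣m)
  2∣oddPart (suc zero) _ 4∣2m = *-cancelˡ-∣ 2 4∣2m
  2∣oddPart (suc (suc _)) (s≤s ())

prime∤⇒coprime : ∀ {p n} → Prime p → ¬ p ∣ n → Coprime p n
prime∤⇒coprime pp p∤n (d∣p , d∣n) with prime⇒irreducible pp d∣p
... | inj₁ d≡1 = d≡1
... | inj₂ refl = ⊥-elim (p∤n d∣n)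

CycleAdj : (n : ℕ) → Fin n → Fin n → Set
CycleAdj n i j = Next n i j ⊎ Next n j i

Next-injective : ∀ {n} {i a b : Fin n} → Next n a i → Next n b i → a ≡ b
Next-injective (inj₁ e)       (inj₁ e′)       = toℕ-injective (suc-injective (trans e (sym e′)))
Next-injective (inj₁ e)       (inj₂ (_ , e′)) with () ← trans e e′
Next-injective (inj₂ (_ , e)) (inj₁ e′)       with () ← trans e′ e
Next-injective (inj₂ (e , _)) (inj₂ (e′ , _)) = toℕ-injective (suc-injective (trans e (sym e′)))

Next-functional : ∀ {n} {i a b : Fin n} → Next n i a → Next n i b → a ≡ b
Next-functional (inj₁ e) (inj₁ e′) = toℕ-injective (trans (sym e) e′)
Next-functional {n} {a = a} (inj₁ e) (inj₂ (e′ , _)) =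
  ⊥-elim (<-irrefl refl (subst (_< n) (trans (sym e) e′) (toℕ<n a)))
Next-functional {n} {b = b} (inj₂ (e′ , _)) (inj₁ e) =
  ⊥-elim (<-irrefl refl (subst (_< n) (trans (sym e) e′) (toℕ<n b)))
Next-functional (inj₂ (_ , e)) (inj₂ (_ , e′)) = toℕ-injective (trans e (sym e′))

CycleAdj-noThreeNeighbours : ∀ {n} {i a b c : Fin n} → a ≢ b → a ≢ c → b ≢ c →
                             CycleAdj n a i → CycleAdj n b i → CycleAdj n c i → ⊥
CycleAdj-noThreeNeighbours a≢b a≢c b≢c (inj₁ a→i) (inj₁ b→i) _          = a≢b (Next-injective a→i b→i)
CycleAdj-noThreeNeighbours a≢b a≢c b≢c (inj₂ i→a) (inj₂ i→b) _          = a≢b (Next-functional i→a i→b)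
CycleAdj-noThreeNeighbours a≢b a≢c b≢c (inj₁ a→i) (inj₂ i→b) (inj₁ c→i) = a≢c (Next-injective a→i c→i)
CycleAdj-noThreeNeighbours a≢b a≢c b≢c (inj₁ a→i) (inj₂ i→b) (inj₂ i→c) = b≢c (Next-functional i→b i→c)
CycleAdj-noThreeNeighbours a≢b a≢c b≢c (inj₂ i→a) (inj₁ b→i) (inj₁ c→i) = b≢c (Next-injective b→i c→i)
CycleAdj-noThreeNeighbours a≢b a≢c b≢c (inj₂ i→a) (inj₁ b→i) (inj₂ i→c) = a≢c (Next-functional i→a i→c)

injective⇒strictlySurjective : ∀ {n} {f : Fin n → Fin n} →
                               Injective _≡_ _≡_ f → StrictlySurjective _≡_ f
injective⇒strictlySurjective {suc n} {f} f-inj y with any? (λ i → f i ≟ y)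
... | yes hit  = hit
... | no  miss = contradiction (injective⇒≤ punched-inj) 1+n≰n
  where
  punched : Fin (suc n) → Fin n
  punched i = punchOut (λ y≡fi → miss (i , sym y≡fi))
  punched-inj : Injective _≡_ _≡_ punched
  punched-inj = f-inj ∘ punchOut-injective {i = y} _ _

GIsCycle⇒noThreeNeighbours : ∀ {n} → GIsCycle n → {v a b c : Fin n} → a ≢ b → a ≢ c → b ≢ c →
                             Adj n a v → Adj n b v → Adj n c v → ⊥
GIsCycle⇒noThreeNeighbours {n} (_ , σ , σ-inj , σ-iso) {v} a≢b a≢c b≢c a~v b~v c~v =
  CycleAdj-noThreeNeighbours (distinct a≢b) (distinct a≢c) (distinct b≢c) (pull a~v) (pull b~v) (pull c~v)
  where
  preimage : Fin n → Fin n
  preimage y = proj₁ (injective⇒strictlySurjective σ-inj y)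
  section : ∀ y → σ (preimage y) ≡ y
  section y = proj₂ (injective⇒strictlySurjective σ-inj y)
  distinct : ∀ {x y} → x ≢ y → preimage x ≢ preimage y
  distinct {x} {y} x≢y eq = x≢y (trans (sym (section x)) (trans (cong σ eq) (section y)))
  pull : ∀ {x} → Adj n x v → CycleAdj n (preimage x) (preimage v)
  pull {x} x~v = Equivalence.to (σ-iso _ _) (subst₂ (Adj n) (sym (section x)) (sym (section v)) x~v)

n∣∣m%n-m∣ : ∀ n m .{{_ : NonZero n}} → n ∣ ℤ.∣ + (m % n) - + m ∣
n∣∣m%n-m∣ n m = divides (m / n) (begin
  ℤ.∣ + (m % n) - + m ∣          ≡⟨ cong ℤ.∣_∣ (ℤ.m-n≡m⊖n (m % n) m) ⟩
  ℤ.∣ (m % n) ⊖ m ∣              ≡⟨ ℤ.∣⊖∣-≤ (m%n≤m m n) ⟩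
  m ∸ m % n                      ≡⟨ cong (_∸ m % n) (m≡m%n+[m/n]*n m n) ⟩
  (m % n + m / n * n) ∸ m % n    ≡⟨ m+n∸m≡n (m % n) (m / n * n) ⟩
  m / n * n                      ∎)
  where open ≡-Reasoning

%≡%⇒∣∸ : ∀ n a b .{{_ : NonZero n}} → a % n ≡ b % n → n ∣ b ∸ a
%≡%⇒∣∸ n a b a≡b = divides (b / n ∸ a / n) (begin
  b ∸ a                                      ≡⟨ cong₂ _∸_ (m≡m%n+[m/n]*n b n) (m≡m%n+[m/n]*n a n) ⟩
  (b % n + b / n * n) ∸ (a % n + a / n * n)  ≡⟨ cong (λ r → (b % n + b / n * n) ∸ (r + a / n * n)) a≡b ⟩
  (b % n + b / n * n) ∸ (b % n + a / n * n)  ≡⟨ [m+n]∸[m+o]≡n∸o (b % n) _ _ ⟩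
  b / n * n ∸ a / n * n                      ≡⟨ *-distribʳ-∸ n (b / n) (a / n) ⟨
  (b / n ∸ a / n) * n                        ∎)
  where open ≡-Reasoning

module _ (m : ℕ) where

  private
    n : ℕ
    n = suc m

  square-adj-0 : ∀ {x} → x < n → Coprime x n → ¬ n ∣ x * x → Adj n ((x * x) mod n) zero
  square-adj-0 {x} x<n x⊥n n∤x² = residue≢0 , fromℕ< x<n , unit , divisible
    where
    residue≢0 : (x * x) mod n ≢ zero
    residue≢0 eq =
      n∤x² (m%n≡0⇒n∣m (x * x) n (trans (sym (toℕ-fromℕ< (m%n<n (x * x) n))) (cong toℕ eq)))
    unit : Coprime (toℕ (fromℕ< x<n)) n
    unit = subst (λ k → Coprime k n) (sym (toℕ-fromℕ< x<n)) x⊥n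
    divisible : + n ∣ℤ ((+ toℕ ((x * x) mod n) - + 0) - + (toℕ (fromℕ< x<n) * toℕ (fromℕ< x<n)))
    divisible rewrite toℕ-fromℕ< (m%n<n (x * x) n) | toℕ-fromℕ< x<n | ℤ.+-identityʳ (+ ((x * x) % n)) =
      n∣∣m%n-m∣ n (x * x)

  square-mod≡⇒∣∸ : ∀ x y → (x * x) mod n ≡ (y * y) mod n → n ∣ y * y ∸ x * x
  square-mod≡⇒∣∸ x y eq = %≡%⇒∣∸ n (x * x) (y * y)
    (trans (sym (toℕ-fromℕ< (m%n<n (x * x) n))) (trans (cong toℕ eq) (toℕ-fromℕ< (m%n<n (y * y) n))))

-- The residues 1, 3, 7 exist mod n, and their squares 1, 9, 49 are nonzero and
-- pairwise distinct mod n (their differences being 8, 48, 40).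
SquaresOf137Separated : ℕ → Set
SquaresOf137Separated n = 8 ≤ n × ¬ n ∣ 1 × ¬ n ∣ 9 × ¬ n ∣ 49 × ¬ n ∣ 8 × ¬ n ∣ 48 × ¬ n ∣ 40

squaresOf137Separated? : Decidable SquaresOf137Separated
squaresOf137Separated? n =
  8 ≤? n ×-dec ¬? (n ∣? 1) ×-dec ¬? (n ∣? 9) ×-dec ¬? (n ∣? 49) ×-dec ¬? (n ∣? 8) ×-dec ¬? (n ∣? 48) ×-dec ¬? (n ∣? 40)

squaresOf137Separated-large : ∀ {n} → 50 ≤ n → SquaresOf137Separated n
squaresOf137Separated-large {n} 50≤n =
  ≤-trans (toWitness {a? = 8 ≤? 50} _) 50≤n , ∤ 1 , ∤ 9 , ∤ 49 , ∤ 8 , ∤ 48 , ∤ 40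
  where
  ∤ : ∀ d .{{_ : NonZero d}} → {True (d <? 50)} → ¬ n ∣ d
  ∤ d {d<50} n∣d = <-irrefl refl (<-≤-trans (toWitness d<50) (≤-trans 50≤n (∣⇒≤ n∣d)))

squaresOf137Separated : ∀ n → ¬ 3 ∣ n → ¬ 4 ∣ n → ¬ 7 ∣ n → 3 ≤ n → n ≢ 5 → n ≢ 10 →
                        SquaresOf137Separated n
squaresOf137Separated n with n <? 50
... | no  n≮50 = λ _ _ _ _ _ _ → squaresOf137Separated-large (≮⇒≥ n≮50)
... | yes n<50 = subst Claim (toℕ-fromℕ< n<50) (checked (fromℕ< n<50))
  where
  Claim : ℕ → Set
  Claim n = ¬ 3 ∣ n → ¬ 4 ∣ n → ¬ 7 ∣ n → 3 ≤ n → n ≢ 5 → n ≢ 10 → SquaresOf137Separated n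
  claim? : Decidable Claim
  claim? n = ¬? (3 ∣? n) →-dec ¬? (4 ∣? n) →-dec ¬? (7 ∣? n) →-dec 3 ≤? n →-dec
             ¬? (n ≟ℕ 5) →-dec ¬? (n ≟ℕ 10) →-dec squaresOf137Separated? n
  checked : ∀ (k : Fin 50) → Claim (toℕ k)
  checked = toWitness {a? = all? (λ k → claim? (toℕ k))} _

prime[3] : Prime 3
prime[3] = toWitness {a? = prime? 3} _

prime[7] : Prime 7
prime[7] = toWitness {a? = prime? 7} _

¬GIsCycle : ∀ {n} → ¬ 3 ∣ n → ¬ 7 ∣ n → SquaresOf137Separated n → ¬ GIsCycle n
¬GIsCycle {suc m} 3∤n 7∤n (8≤n , n∤1 , n∤9 , n∤49 , n∤8 , n∤48 , n∤40) cyc =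
  GIsCycle⇒noThreeNeighbours cyc (distinct 1 3 n∤8) (distinct 1 7 n∤48) (distinct 3 7 n∤40)
    (square-adj-0 m (≤-trans (toWitness {a? = 2 ≤? 8} _) 8≤n) (1-coprimeTo n) n∤1)
    (square-adj-0 m (≤-trans (toWitness {a? = 4 ≤? 8} _) 8≤n) (prime∤⇒coprime prime[3] 3∤n) n∤9)
    (square-adj-0 m 8≤n (prime∤⇒coprime prime[7] 7∤n) n∤49)
  where
  n : ℕ
  n = suc m
  distinct : ∀ x y → ¬ n ∣ y * y ∸ x * x → (x * x) mod n ≢ (y * y) mod n
  distinct x y n∤ eq = n∤ (square-mod≡⇒∣∸ m x y eq)

adj⇔cycleAdj⇒GIsCycle : ∀ {n} → 3 ≤ n → (∀ i j → Adj n i j ⇔ CycleAdj n i j) → GIsCycle n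
adj⇔cycleAdj⇒GIsCycle 3≤n adj⇔ = 3≤n , id , id , adj⇔

adj? : ∀ n → Decidable₂ (Adj n)
adj? n a b = ¬? (a ≟ b) ×-dec
  any? (λ x → coprime? (toℕ x) n ×-dec (n ∣? ℤ.∣ (+ toℕ a - + toℕ b) - + (toℕ x * toℕ x) ∣))

cycleAdj? : ∀ n → Decidable₂ (CycleAdj n)
cycleAdj? n i j = next? i j ⊎-dec next? j i
  where
  next? : Decidable₂ (Next n)
  next? i j = (suc (toℕ i) ≟ℕ toℕ j) ⊎-dec ((suc (toℕ i) ≟ℕ n) ×-dec (toℕ j ≟ℕ 0))

GIsCycle-byIdentity : ∀ n → {True (3 ≤? n)} →
                      {True (all? λ i → all? λ j → adj? n i j →-dec cycleAdj? n i j)} →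
                      {True (all? λ i → all? λ j → cycleAdj? n i j →-dec adj? n i j)} → GIsCycle n
GIsCycle-byIdentity n {3≤n} {adj⇒} {cycleAdj⇒} =
  adj⇔cycleAdj⇒GIsCycle (toWitness 3≤n) λ i j → mk⇔ (toWitness adj⇒ i j) (toWitness cycleAdj⇒ i j)

proposition3p5 : (n : ℕ) → HasForm n → (GIsCycle n ⇔ (n ≡ 5 ⊎ n ≡ 10))
proposition3p5 n hf = mk⇔ cycle⇒5or10 λ where
    (inj₁ refl) → GIsCycle-byIdentity 5
    (inj₂ refl) → GIsCycle-byIdentity 10
  where
  cycle⇒5or10 : GIsCycle n → n ≡ 5 ⊎ n ≡ 10
  cycle⇒5or10 cyc with n ≟ℕ 5 | n ≟ℕ 10
  ... | yes n≡5 | _        = inj₁ n≡5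
  ... | no _    | yes n≡10 = inj₂ n≡10
  ... | no n≢5  | no n≢10  = ⊥-elim (¬GIsCycle 3∤n 7∤n separated cyc)
    where
    3∤n : ¬ 3 ∣ n
    3∤n = HasForm∧prime≡3mod4⇒∤ hf prime[3] refl
    7∤n : ¬ 7 ∣ n
    7∤n = HasForm∧prime≡3mod4⇒∤ hf prime[7] refl
    separated : SquaresOf137Separated n
    separated = squaresOf137Separated n 3∤n (HasForm⇒4∤ hf) 7∤n (proj₁ cyc) n≢5 n≢10
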